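{- Let $n \geq 30$ and consider the Zeckendorf game on $n$ with $p=6$ players divided into two alliances, one with $4$ players and one with $2$ players (in any positions). Then the $4$-player alliance always has a winning strategy.
   Context: Let $F_1=1$, $F_2=2$, $F_{i+1}=F_i+F_{i-1}$. The Zeckendorf game on $n$ starts with the multiset of $n$ copies of $1$. A move is one of: if the list contains $F_{i-1}$ and $F_i$, replace them by $F_{i+1}$; if the list contains two copies of $F_i$: for $i=1$ replace them by $F_2$; for $i=2$ replace them by $F_1,F_3$; for $i\geq 3$ replace them by $F_{i-2},F_{i+1}$. The game ends when the list is the Zeckendorf decomposition of $n$ (distinct, pairwise non-consecutive Fibonacci numbers); every game terminates. With $p$ players, players $1,\dots,p$ move in cyclic order $1,2,\dots,p,1,2,\dots$ starting with player 1. Players are partitioned into alliances; an alliance wins if the final move (creating the Zeckendorf decomposition) is made by one of its members. An alliance has a winning strategy if its members can choose their moves so that the final move is made by a member no matter what moves the other players make. -}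

module Defs where

open import Data.Nat using (ℕ; zero; suc; _+_)
open import Data.Nat.DivMod using (_mod_)
open import Data.Fin using (Fin; toℕ)
open import Data.Fin.Subset using (Subset; _∈_; _∉_)
open import Data.List using (List; []; _∷_; _++_)
open import Data.List.Relation.Unary.AllPairs using (AllPairs)
open import Data.List.Relation.Binary.Permutation.Propositional using (_↭_)
open import Data.Product using (Σ; _×_)
open import Data.Sum using (_⊎_)
open import Relation.Binary.PropositionalEquality using (_≢_)
open import Relation.Nullary using (¬_)

-- Fibonacci numbers of the paper: F₁ = 1, F₂ = 2, F_{i+1} = F_i + F_{i-1}.
-- We use 0-based indices: fib k = F_{k+1}.
fib : ℕ → ℕ
fib zero = 1
fib (suc zero) = 2
fib (suc (suc k)) = fib (suc k) + fib k

-- A game state is a multiset of Fibonacci numbers, represented as a list of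
-- (0-based) indices, considered up to permutation (_↭_).
State : Set
State = List ℕ

-- Rule rem add : the sub-multiset `rem` may be replaced by `add`.
data Rule : List ℕ → List ℕ → Set where
  -- F_{i-1}, F_i  ↦  F_{i+1}   (i ≥ 2;  k = i - 2)
  combine : ∀ k → Rule (k ∷ suc k ∷ []) (suc (suc k) ∷ [])
  split1  : Rule (0 ∷ 0 ∷ []) (1 ∷ [])
  split2  : Rule (1 ∷ 1 ∷ []) (0 ∷ 2 ∷ [])
  -- 2 F_i ↦ F_{i-2}, F_{i+1}   (i ≥ 3;  k = i - 3)
  splitI  : ∀ k → Rule (suc (suc k) ∷ suc (suc k) ∷ []) (k ∷ suc (suc (suc k)) ∷ [])

Move : State → State → Set
Move s t = Σ (List ℕ) λ rem → Σ (List ℕ) λ add → Σ (List ℕ) λ r →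
  Rule rem add × (s ↭ rem ++ r) × (t ↭ add ++ r)

Zeck : State → Set
Zeck s = AllPairs (λ a b → (a ≢ b) × (a ≢ suc b) × (b ≢ suc a)) s

-- Next player in cyclic order among p players (players 1..p are Fin p, player 1 = zero).
next : ∀ {p} → Fin (suc p) → Fin (suc p)
next {p} i = suc (toℕ i) mod (suc p)

-- Wins A s j : alliance A (a set of players) has a winning strategy from the
-- (non-final) state s when player j is to move.  Inductive, hence finite strategy trees.
data Wins {p : ℕ} (A : Subset (suc p)) : State → Fin (suc p) → Set where
  ours   : ∀ {s j} t → j ∈ A → Move s t → (Zeck t ⊎ Wins A t (next j)) → Wins A s j
  theirs : ∀ {s j} → j ∉ A → Σ State (Move s) →
           (∀ t → Move s t → ¬ Zeck t × Wins A t (next j)) → Wins A s j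

-- The game is finite (a weight of the multiset drops with every move) and hence
-- determined: of two complementary alliances, one can force the final move.
-- This enables strategy stealing.  Suppose alliance A can steer play from a
-- position either to a multiset e with player j to move, or to the same e with
-- the player k turns after j to move, where shifting every player by k turns
-- maps the complement of A into A.  If A loses from e at player j, the
-- complement's winning strategy there, played by the shifted players, wins for A
-- from e k turns later.  For each of the fifteen alliances of size 4 a finite
-- certificate -- A's moves, all opponent replies, and such stealing positions at
-- its leaves -- is verified by evaluation from 30 ones.  Every position it
-- visits contains two ones, so a move using one of any further ones is matched
-- by one that does not, and the certificate works for all n ≥ 30.

module Submission where

open import Defs
open import Data.Nat using (ℕ; zero; suc; _+_; _∸_; _<_; _≤_; _≡ᵇ_; s≤s)
open import Relation.Binary.PropositionalEquality using (_≡_; _≢_; refl; sym; trans; cong; subst; setoid; resp₂)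
open import Data.Nat.Properties
  using (_≟_; ≤-decTotalOrder; ≤-refl; ≤-reflexive; ≤-trans; <ᵇ⇒<; ≤ᵇ⇒≤; ≡⇒≡ᵇ; +-monoˡ-<; +-monoˡ-≤; +-monoʳ-≤;
         m≤n+m; +-identityʳ; +-suc; m≤n⇒∃[o]m+o≡n; module ≤-Reasoning)
open import Data.Bool using (Bool; true; false; _∧_; _∨_; not; T)
open import Data.Bool.Properties using (T-∧)
open import Data.Fin using (Fin; zero)
import Data.Fin as Fin
open import Data.Fin.Properties using (all?)
open import Data.Fin.Subset using (Subset; ∁; ∣_∣; inside; outside) renaming (_∈_ to _∈ₛ_; _∉_ to _∉ₛ_)
open import Data.Fin.Subset.Properties using (x∈p⇒x∉∁p; x∉p⇒x∈∁p) renaming (_∈?_ to _∈ₛ?_)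
open import Data.List using (List; []; _∷_; _++_; map; concatMap; downFrom; replicate; length)
open import Data.List.Extrema.Nat using (max; xs≤max)
open import Data.List.Membership.DecPropositional _≟_ using (_∈?_)
open import Data.List.Membership.Propositional using (_∈_; find; lose)
open import Data.List.Membership.Propositional.Properties
  using (∈-++⁻; ∈-++⁺ˡ; ∈-++⁺ʳ; ∈-concatMap⁺; ∈-concatMap⁻; ∈-downFrom⁺)
open import Data.List.Properties using (++-assoc; ++-identityʳ; map-++; ≡-dec)
open import Data.List.Relation.Binary.Permutation.Propositional
  using (_↭_; prep; swap; ↭-refl; ↭-sym; ↭-trans; ↭-reflexive; ↭⇒↭ₛ)
open import Data.List.Relation.Binary.Permutation.Propositional.Properties
  using (++⁺ʳ; ++⁺ˡ; drop-∷; ∈-resp-↭; shift; map⁺)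
open import Data.List.Relation.Binary.Permutation.Setoid.Properties (setoid ℕ) using (AllPairs-resp-↭)
open import Data.List.Relation.Binary.Subset.Propositional using (_⊆_)
open import Data.List.Relation.Unary.All using (All; []; _∷_)
import Data.List.Relation.Unary.All as All
open import Data.List.Relation.Unary.All.Properties using (¬All⇒Any¬; replicate⁺)
open import Data.List.Relation.Unary.AllPairs using ([]; _∷_; allPairs?)
open import Data.List.Relation.Unary.Any using (Any; here; there)
import Data.List.Relation.Unary.Any as Any
open import Data.List.Sort.InsertionSort.Base ≤-decTotalOrder using (sort)
open import Data.List.Sort.InsertionSort.Properties ≤-decTotalOrder using (sort-↭)
open import Data.Maybe using (Maybe; just; nothing)
open import Data.Nat.GeneralisedArithmetic using (iterate)
open import Data.Nat.Induction using (<-wellFounded)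
open import Data.Nat.ListAction using (sum)
open import Data.Nat.ListAction.Properties using (sum-++; sum-↭)
open import Data.Product using (∃; _×_; _,_; proj₁; proj₂)
open import Data.Sum using (_⊎_; inj₁; inj₂)
import Data.Sum as Sum
open import Data.Vec using ([]; _∷_)
open import Function using (_∘_)
open import Function.Bundles using (Equivalence)
open import Induction.WellFounded using (Acc; acc)
open import Relation.Nullary using (¬_; Dec; yes; no; contradiction)
open import Relation.Nullary.Decidable using (isYes; toWitness; ¬?; _×-dec_; _→-dec_)

remove : ℕ → List ℕ → List ℕ
remove x [] = []
remove x (y ∷ ys) with x ≟ y
... | yes _ = ys
... | no _ = y ∷ remove x ys

↭-remove : ∀ {x xs} → x ∈ xs → xs ↭ x ∷ remove x xs
↭-remove {x} {y ∷ ys} (here refl) with x ≟ x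
... | yes _ = ↭-refl
... | no x≢x = contradiction refl x≢x
↭-remove {x} {y ∷ ys} (there x∈ys) with x ≟ y
... | yes refl = ↭-refl
... | no _ = ↭-trans (prep y (↭-remove x∈ys)) (swap y x ↭-refl)

∈-remove⁺ : ∀ {x y xs} → x ∈ xs → x ≢ y → x ∈ remove y xs
∈-remove⁺ {x} {y} {z ∷ zs} (here refl) x≢y with y ≟ x
... | yes refl = contradiction refl x≢y
... | no _ = here refl
∈-remove⁺ {x} {y} {z ∷ zs} (there x∈zs) x≢y with y ≟ z
... | yes _ = x∈zs
... | no _ = there (∈-remove⁺ x∈zs x≢y)

∈-remove⁻ : ∀ {x y xs} → x ∈ remove y xs → x ∈ xs
∈-remove⁻ {y = y} {z ∷ zs} x∈ with y ≟ z | x∈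
... | yes _ | x∈zs = there x∈zs
... | no _ | here x≡z = here x≡z
... | no _ | there x∈ = there (∈-remove⁻ x∈)

↭-remove₂ : ∀ {a b xs} → a ∈ xs → b ∈ remove a xs → xs ↭ a ∷ b ∷ remove b (remove a xs)
↭-remove₂ a∈ b∈ = ↭-trans (↭-remove a∈) (prep _ (↭-remove b∈))

Any⊎All : ∀ {A : Set} {P Q : A → Set} xs → (∀ {x} → x ∈ xs → P x ⊎ Q x) → Any P xs ⊎ All Q xs
Any⊎All [] _ = inj₂ []
Any⊎All (x ∷ xs) P⊎Q with P⊎Q (here refl) | Any⊎All xs (P⊎Q ∘ there)
... | inj₁ px | _ = inj₁ (here px)
... | inj₂ _ | inj₁ any = inj₁ (there any)
... | inj₂ qx | inj₂ all = inj₂ (qx ∷ all)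

iterate-comm : ∀ {X : Set} (f : X → X) x n → iterate f (f x) n ≡ f (iterate f x n)
iterate-comm f x zero = refl
iterate-comm f x (suc n) = iterate-comm f (f x) n

nth : ∀ {X : Set} → List X → ℕ → Maybe X
nth [] _ = nothing
nth (x ∷ xs) zero = just x
nth (x ∷ xs) (suc i) = nth xs i

nth-∈ : ∀ {X : Set} (xs : List X) i {x} → nth xs i ≡ just x → x ∈ xs
nth-∈ (x ∷ xs) zero refl = here refl
nth-∈ (x ∷ xs) (suc i) eq = there (nth-∈ xs i eq)

all-subsets : ∀ {n} → (Subset n → Bool) → Bool
all-subsets {zero} f = f []
all-subsets {suc n} f = all-subsets (f ∘ (inside ∷_)) ∧ all-subsets (f ∘ (outside ∷_))

all-subsets-sound : ∀ {n} (f : Subset n → Bool) → T (all-subsets f) → ∀ A → T (f A)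
all-subsets-sound {zero} f ok [] = ok
all-subsets-sound {suc n} f ok (inside ∷ A) =
  all-subsets-sound (f ∘ (inside ∷_)) (proj₁ (Equivalence.to T-∧ ok)) A
all-subsets-sound {suc n} f ok (outside ∷ A) =
  all-subsets-sound (f ∘ (outside ∷_)) (proj₂ (Equivalence.to T-∧ ok)) A

T-implication : ∀ {a b} → T a → T (not a ∨ b) → T b
T-implication {true} _ b = b

split : ℕ → List ℕ
split zero = 1 ∷ []
split (suc zero) = 0 ∷ 2 ∷ []
split (suc (suc k)) = k ∷ suc (suc (suc k)) ∷ []

split-rule : ∀ i → Rule (i ∷ i ∷ []) (split i)
split-rule zero = split1
split-rule (suc zero) = split2
split-rule (suc (suc k)) = splitI k

Move-respˡ-↭ : ∀ {s s′ t} → s′ ↭ s → Move s t → Move s′ t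
Move-respˡ-↭ s′↭s (rem , add , r , ρ , s↭ , t↭) = rem , add , r , ρ , ↭-trans s′↭s s↭ , t↭

Move-respʳ-↭ : ∀ {s t t′} → t′ ↭ t → Move s t → Move s t′
Move-respʳ-↭ t′↭t (rem , add , r , ρ , s↭ , t↭) = rem , add , r , ρ , s↭ , ↭-trans t′↭t t↭

Move-∷ : ∀ {s t} x → Move s t → Move (x ∷ s) (x ∷ t)
Move-∷ x (rem , add , r , ρ , s↭ , t↭) =
  rem , add , x ∷ r , ρ ,
  ↭-trans (prep x s↭) (↭-sym (shift x rem r)) , ↭-trans (prep x t↭) (↭-sym (shift x add r))

fire : ∀ {a b add} → Rule (a ∷ b ∷ []) add → List ℕ → List (List ℕ)
fire {a} {b} {add} _ c with a ∈? c | b ∈? remove a c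
... | yes _ | yes _ = (add ++ remove b (remove a c)) ∷ []
... | _ | _ = []

fire-sound : ∀ {a b add c c′} (ρ : Rule (a ∷ b ∷ []) add) → c′ ∈ fire ρ c →
             ∀ z → Move (c ++ z) (c′ ++ z)
fire-sound {a} {b} {add} {c} ρ c′∈ z with a ∈? c | b ∈? remove a c | c′∈
... | yes a∈c | yes b∈ | here refl =
  _ , _ , remove b (remove a c) ++ z , ρ , ++⁺ʳ z (↭-remove₂ a∈c b∈) , ↭-reflexive (++-assoc add _ z)

fire-complete : ∀ {a b add c} (ρ : Rule (a ∷ b ∷ []) add) → a ∈ c → b ∈ remove a c →
                add ++ remove b (remove a c) ∈ fire ρ c
fire-complete {a} {b} {c = c} ρ a∈c b∈ with a ∈? c | b ∈? remove a c
... | yes _ | yes _ = here refl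
... | no a∉c | _ = contradiction a∈c a∉c
... | yes _ | no b∉ = contradiction b∈ b∉

firingsAt : ℕ → List ℕ → List (List ℕ)
firingsAt a c = fire (combine a) c ++ fire (split-rule a) c

-- Certificates index into this list, so its order is part of their format.
successors : State → List State
successors c = concatMap (λ a → firingsAt a c) (downFrom (suc (max 0 c)))

fire⊆firingsAt : ∀ {a b add c} (ρ : Rule (a ∷ b ∷ []) add) → fire ρ c ⊆ firingsAt a c
fire⊆firingsAt (combine k) = ∈-++⁺ˡ
fire⊆firingsAt {c = c} split1 = ∈-++⁺ʳ (fire (combine 0) c)
fire⊆firingsAt {c = c} split2 = ∈-++⁺ʳ (fire (combine 1) c)
fire⊆firingsAt {c = c} (splitI k) = ∈-++⁺ʳ (fire (combine (suc (suc k))) c)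

firingsAt⊆successors : ∀ {a c} → a ∈ c → firingsAt a c ⊆ successors c
firingsAt⊆successors {a} {c} a∈c c′∈ =
  ∈-concatMap⁺ (λ a → firingsAt a c)
    (lose (∈-downFrom⁺ (s≤s (All.lookup (xs≤max 0 c) a∈c))) c′∈)

successors-sound : ∀ {c c′} → c′ ∈ successors c → ∀ z → Move (c ++ z) (c′ ++ z)
successors-sound {c} c′∈
  with find (∈-concatMap⁻ (λ a → firingsAt a c) {downFrom (suc (max 0 c))} c′∈)
... | a , _ , c′∈firings with ∈-++⁻ (fire (combine a) c) c′∈firings
...   | inj₁ c′∈ = fire-sound (combine a) c′∈
...   | inj₂ c′∈ = fire-sound (split-rule a) c′∈

absorb : ∀ {a c z r} → z ⊆ c → c ++ z ↭ a ∷ r → a ∈ c × remove a c ++ z ↭ r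
absorb {a} {c} {z} z⊆c c++z↭ = a∈c , drop-∷ (↭-trans (↭-sym (++⁺ʳ z (↭-remove a∈c))) c++z↭)
  where
  a∈c : a ∈ c
  a∈c with ∈-++⁻ c (∈-resp-↭ (↭-sym c++z↭) (here refl))
  ... | inj₁ a∈c = a∈c
  ... | inj₂ a∈z = z⊆c a∈z

rule-complete : ∀ {a b add c z r t} → (∀ x → z ⊆ remove x c) → (ρ : Rule (a ∷ b ∷ []) add) →
                c ++ z ↭ a ∷ b ∷ r → t ↭ add ++ r → Any (λ c′ → t ↭ c′ ++ z) (successors c)
rule-complete {add = add} {z = z} absorbs ρ s↭ t↭ =
  let a∈c , s↭′ = absorb (∈-remove⁻ ∘ absorbs 0) s↭
      b∈ , s↭″ = absorb (absorbs _) s↭′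
  in lose (firingsAt⊆successors a∈c (fire⊆firingsAt ρ (fire-complete ρ a∈c b∈)))
          (↭-trans t↭ (↭-trans (++⁺ˡ add (↭-sym s↭″)) (↭-reflexive (sym (++-assoc add _ z)))))

-- A move consumes two entries, so one taken from z can be taken from c instead
-- as long as z's entries survive in c the removal of any single entry.
successors-complete : ∀ {c z t} → (∀ x → z ⊆ remove x c) → Move (c ++ z) t →
                      Any (λ c′ → t ↭ c′ ++ z) (successors c)
successors-complete absorbs (_ , _ , _ , combine k , s↭ , t↭) = rule-complete absorbs (combine k) s↭ t↭
successors-complete absorbs (_ , _ , _ , split1 , s↭ , t↭) = rule-complete absorbs split1 s↭ t↭
successors-complete absorbs (_ , _ , _ , split2 , s↭ , t↭) = rule-complete absorbs split2 s↭ t↭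
successors-complete absorbs (_ , _ , _ , splitI k , s↭ , t↭) = rule-complete absorbs (splitI k) s↭ t↭

successors-sound₀ : ∀ {c c′} → c′ ∈ successors c → Move c c′
successors-sound₀ {c} {c′} c′∈ =
  Move-respʳ-↭ (↭-reflexive (sym (++-identityʳ c′)))
    (Move-respˡ-↭ (↭-reflexive (sym (++-identityʳ c))) (successors-sound c′∈ []))

successors-complete₀ : ∀ {s t} → Move s t → Any (t ↭_) (successors s)
successors-complete₀ {s} m =
  Any.map (λ t↭ → ↭-trans t↭ (↭-reflexive (++-identityʳ _)))
    (successors-complete (λ _ ()) (Move-respˡ-↭ (↭-reflexive (++-identityʳ s)) m))

HasTwoOnes : State → Set
HasTwoOnes c = 0 ∈ remove 0 c

hasTwoOnes? : ∀ c → Dec (HasTwoOnes c)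
hasTwoOnes? c = 0 ∈? remove 0 c

HasTwoOnes⇒Move : ∀ {c} → HasTwoOnes c → ∀ z → ∃ (Move (c ++ z))
HasTwoOnes⇒Move two z = _ , fire-sound split1 (fire-complete split1 (∈-remove⁻ two) two) z

ones-absorbed : ∀ {c z} → All (_≡ 0) z → HasTwoOnes c → ∀ x → z ⊆ remove x c
ones-absorbed ones two x y∈z with All.lookup ones y∈z
ones-absorbed ones two zero y∈z | refl = two
ones-absorbed {c} ones two (suc x) y∈z | refl = ∈-remove⁺ {xs = c} (∈-remove⁻ two) λ ()

weight : ℕ → ℕ
weight zero = 4
weight (suc i) = 7 + i

size : State → ℕ
size s = sum (map weight s)

size-↭ : ∀ {s t} → s ↭ t → size s ≡ size t
size-↭ s↭t = sum-↭ (map⁺ weight s↭t)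

size-++ : ∀ s t → size (s ++ t) ≡ size s + size t
size-++ s t = trans (cong sum (map-++ weight s t)) (sum-++ (map weight s) (map weight t))

weight≤6+ : ∀ i → weight i ≤ 6 + i
weight≤6+ zero = ≤ᵇ⇒≤ 4 6 _
weight≤6+ (suc i) = ≤-refl

rule-decreasing : ∀ {rem add} → Rule rem add → size add < size rem
rule-decreasing (combine zero) = <ᵇ⇒< 8 11 _
rule-decreasing (combine (suc k)) rewrite +-identityʳ k =
  +-monoʳ-≤ 7 (≤-trans (+-monoˡ-≤ k (≤ᵇ⇒≤ 3 8 _)) (m≤n+m (8 + k) k))
rule-decreasing split1 = <ᵇ⇒< 7 8 _
rule-decreasing split2 = <ᵇ⇒< 12 14 _
rule-decreasing (splitI k) rewrite +-identityʳ k =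
  ≤-trans (s≤s (+-monoˡ-≤ (9 + k) (weight≤6+ k))) (≤-reflexive (cong (7 +_) (+-suc k (8 + k))))

Move-decreasing : ∀ {s t} → Move s t → size t < size s
Move-decreasing {s} {t} (rem , add , r , ρ , s↭ , t↭) = begin-strict
  size t              ≡⟨ size-↭ t↭ ⟩
  size (add ++ r)     ≡⟨ size-++ add r ⟩
  size add + size r   <⟨ +-monoˡ-< (size r) (rule-decreasing ρ) ⟩
  size rem + size r   ≡⟨ size-++ rem r ⟨
  size (rem ++ r)     ≡⟨ size-↭ s↭ ⟨
  size s              ∎
  where open ≤-Reasoning

Apart : ℕ → ℕ → Set
Apart a b = (a ≢ b) × (a ≢ suc b) × (b ≢ suc a)

Apart-sym : ∀ {a b} → Apart a b → Apart b a
Apart-sym (a≢b , a≢1+b , b≢1+a) = (λ b≡a → a≢b (sym b≡a)) , b≢1+a , a≢1+b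

Apart? : ∀ a b → Dec (Apart a b)
Apart? a b = ¬? (a ≟ b) ×-dec ¬? (a ≟ suc b) ×-dec ¬? (b ≟ suc a)

Zeck? : ∀ s → Dec (Zeck s)
Zeck? = allPairs? Apart?

Zeck-resp-↭ : ∀ {s t} → s ↭ t → Zeck s → Zeck t
Zeck-resp-↭ s↭t = AllPairs-resp-↭ Apart-sym (resp₂ Apart) (↭⇒↭ₛ s↭t)

HasTwoOnes⇒¬Zeck : ∀ {c} z → HasTwoOnes c → ¬ Zeck (c ++ z)
HasTwoOnes⇒¬Zeck z two zeck with Zeck-resp-↭ (++⁺ʳ z (↭-remove₂ (∈-remove⁻ two) two)) zeck
... | 0-apart ∷ _ = proj₁ (All.head 0-apart) refl

clash-move : ∀ {x y xs} → y ∈ xs → ¬ Apart x y → ∃ (Move (x ∷ xs))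
clash-move {x} {y} {xs} y∈xs ¬apart with x ≟ y
... | yes refl = _ , _ , _ , remove x xs , split-rule x , prep x (↭-remove y∈xs) , ↭-refl
... | no x≢y with x ≟ suc y
...   | yes refl = _ , _ , _ , remove y xs , combine y ,
                   ↭-trans (prep x (↭-remove y∈xs)) (swap x y ↭-refl) , ↭-refl
...   | no x≢1+y with y ≟ suc x
...     | yes refl = _ , _ , _ , remove y xs , combine x , prep x (↭-remove y∈xs) , ↭-refl
...     | no y≢1+x = contradiction (x≢y , x≢1+y , y≢1+x) ¬apart

Zeck⊎Move : ∀ s → Zeck s ⊎ ∃ (Move s)
Zeck⊎Move [] = inj₁ []
Zeck⊎Move (x ∷ xs) with Zeck⊎Move xs
... | inj₂ (t , m) = inj₂ (x ∷ t , Move-∷ x m)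
... | inj₁ zeck with All.all? (Apart? x) xs
...   | yes apart = inj₁ (apart ∷ zeck)
...   | no ¬apart with find (¬All⇒Any¬ (Apart? x) xs ¬apart)
...     | _ , y∈xs , ¬xy = inj₂ (clash-move y∈xs ¬xy)

some-move : ∀ {s} → ¬ Zeck s → ∃ (Move s)
some-move {s} ¬zeck with Zeck⊎Move s
... | inj₁ zeck = contradiction zeck ¬zeck
... | inj₂ move = move

module _ {p : ℕ} where

  Wins-resp-↭ : ∀ {A : Subset (suc p)} {s s′ j} → s ↭ s′ → Wins A s j → Wins A s′ j
  Wins-resp-↭ s↭s′ (ours t j∈A m next-wins) = ours t j∈A (Move-respˡ-↭ (↭-sym s↭s′) m) next-wins
  Wins-resp-↭ s↭s′ (theirs j∉A (t , m) all-lose) =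
    theirs j∉A (t , Move-respˡ-↭ (↭-sym s↭s′) m) (λ t m → all-lose t (Move-respˡ-↭ s↭s′ m))

  Wins-relabel : ∀ {C D : Subset (suc p)} (σ : Fin (suc p) → Fin (suc p)) →
                 (∀ j → σ (next j) ≡ next (σ j)) → (∀ {i} → i ∈ₛ C → σ i ∈ₛ D) →
                 ∀ {s j} → Wins C s j → Wins D s (σ j)
  Wins-relabel {C} {D} σ σ-next C⇒D = relabel
    where
    relabel : ∀ {s j} → Wins C s j → Wins D s (σ j)
    relabel (ours t j∈C m (inj₁ zeck)) = ours t (C⇒D j∈C) m (inj₁ zeck)
    relabel {j = j} (ours t j∈C m (inj₂ w)) =
      ours t (C⇒D j∈C) m (inj₂ (subst (Wins D t) (σ-next j) (relabel w)))
    relabel {j = j} (theirs j∉C (t₀ , m₀) all-lose) with σ j ∈ₛ? D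
    -- Now D moves where C's opponents did; since every such move loses for them, any one will do.
    ... | yes σj∈D = ours t₀ σj∈D m₀ (inj₂ (next-wins t₀ m₀))
      where next-wins = λ t m → subst (Wins D t) (σ-next j) (relabel (proj₂ (all-lose t m)))
    ... | no σj∉D = theirs σj∉D (t₀ , m₀)
      λ t m → proj₁ (all-lose t m) , subst (Wins D t) (σ-next j) (relabel (proj₂ (all-lose t m)))

  Outcome : Subset (suc p) → Subset (suc p) → State → Fin (suc p) → Set
  Outcome X Y t j = (Zeck t ⊎ Wins X t j) ⊎ (¬ Zeck t × Wins Y t j)

  outcome : ∀ {X Y t j} → Dec (Zeck t) → (¬ Zeck t → Wins X t j ⊎ Wins Y t j) → Outcome X Y t j
  outcome (yes zeck) _ = inj₁ (inj₁ zeck)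
  outcome (no ¬zeck) decided = Sum.map inj₂ (¬zeck ,_) (decided ¬zeck)

  turn-determined : ∀ {X Y s j} → j ∈ₛ X → j ∉ₛ Y → ¬ Zeck s →
                    (∀ t → Move s t → Outcome X Y t (next j)) → Wins X s j ⊎ Wins Y s j
  turn-determined {X} {Y} {s} {j} j∈X j∉Y ¬zeck outcomes =
    Sum.map winning-move all-losing (Any⊎All (successors s) (λ t∈ → outcomes _ (successors-sound₀ t∈)))
    where
    winning-move : Any (λ t → Zeck t ⊎ Wins X t (next j)) (successors s) → Wins X s j
    winning-move good = let t , t∈ , t-good = find good in ours t j∈X (successors-sound₀ t∈) t-good

    all-losing : All (λ t → ¬ Zeck t × Wins Y t (next j)) (successors s) → Wins Y s j
    all-losing bad = theirs j∉Y (some-move ¬zeck) λ t m →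
      let _ , c∈ , t↭c = find (successors-complete₀ m)
          ¬zeck-c , wins-c = All.lookup bad c∈
      in ¬zeck-c ∘ Zeck-resp-↭ t↭c , Wins-resp-↭ (↭-sym t↭c) wins-c

  determined : ∀ (A : Subset (suc p)) s j → ¬ Zeck s → Wins A s j ⊎ Wins (∁ A) s j
  determined A s = go s (<-wellFounded (size s))
    where
    go : ∀ s → Acc _<_ (size s) → ∀ j → ¬ Zeck s → Wins A s j ⊎ Wins (∁ A) s j
    go s (acc rs) j ¬zeck with j ∈ₛ? A
    ... | yes j∈A = turn-determined j∈A (x∈p⇒x∉∁p j∈A) ¬zeck
                      (λ t m → outcome (Zeck? t) (go t (rs (Move-decreasing m)) (next j)))
    ... | no j∉A = Sum.swap (turn-determined (x∉p⇒x∈∁p j∉A) j∉A ¬zeck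
                      (λ t m → outcome (Zeck? t) (Sum.swap ∘ go t (rs (Move-decreasing m)) (next j))))

-- play i κ: the alliance moves to the i-th successor and continues with κ.
-- respond κs: an opponent moves; κs holds one certificate per successor.
-- steal is₁ is₂: the alliance's moves is₁ and is₂ reach the same multiset
-- k = length is₂ ∸ length is₁ turns apart (StealAt).
data Certificate : Set where
  play : ℕ → Certificate → Certificate
  respond : List Certificate → Certificate
  steal : List ℕ → List ℕ → Certificate

module Check {p : ℕ} (A : Subset (suc p)) where

  Player : Set
  Player = Fin (suc p)

  rotate : ℕ → Player → Player
  rotate k j = iterate next j k

  Stealable : ℕ → Set
  Stealable k = ∀ i → i ∈ₛ ∁ A → rotate k i ∈ₛ A

  run : List ℕ → State → Player → Maybe (State × Player)
  run [] c j = just (c , j)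
  run (i ∷ is) c j with j ∈ₛ? A | nth (successors c) i
  ... | yes _ | just c′ = run is c′ (next j)
  ... | _ | _ = nothing

  run-sound : ∀ is {c j e j′} → run is c j ≡ just (e , j′) →
              ∀ z → Wins A (e ++ z) j′ → Wins A (c ++ z) j
  run-sound [] refl z w = w
  run-sound (i ∷ is) {c} {j} eq z w with j ∈ₛ? A | nth (successors c) i in c′-eq
  ... | yes j∈A | just c′ =
    ours (c′ ++ z) j∈A (successors-sound (nth-∈ (successors c) i c′-eq) z) (inj₂ (run-sound is eq z w))

  StealAt : ℕ → State → Player → State → Player → Set
  StealAt k e₁ j₁ e₂ j₂ = HasTwoOnes e₁ × sort e₁ ≡ sort e₂ × j₂ ≡ rotate k j₁ × Stealable k

  steal-at? : ∀ k e₁ j₁ e₂ j₂ → Dec (StealAt k e₁ j₁ e₂ j₂)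
  steal-at? k e₁ j₁ e₂ j₂ =
    hasTwoOnes? e₁ ×-dec (≡-dec _≟_ (sort e₁) (sort e₂)) ×-dec (j₂ Fin.≟ rotate k j₁)
      ×-dec all? (λ i → (i ∈ₛ? ∁ A) →-dec (rotate k i ∈ₛ? A))

  steal-sound : ∀ {k e₁ j₁ e₂ j₂} → StealAt k e₁ j₁ e₂ j₂ → ∀ z →
                Wins A (e₁ ++ z) j₁ ⊎ Wins A (e₂ ++ z) j₂
  steal-sound {k} {e₁} {j₁} {e₂} (two , sorted , refl , stealable) z
    with determined A (e₁ ++ z) j₁ (HasTwoOnes⇒¬Zeck z two)
  ... | inj₁ w = inj₁ w
  ... | inj₂ w = inj₂ (Wins-resp-↭ (++⁺ʳ z e₁↭e₂)
                        (Wins-relabel (rotate k) (λ j → iterate-comm next j k) (stealable _) w))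
    where
    e₁↭e₂ : e₁ ↭ e₂
    e₁↭e₂ = ↭-trans (↭-sym (sort-↭ e₁)) (↭-trans (↭-reflexive sorted) (sort-↭ e₂))

  check : Certificate → State → Player → Bool
  step : Certificate → State → Player → Bool
  checkAll : List Certificate → List State → Player → Bool

  check κ c j = isYes (hasTwoOnes? c) ∧ step κ c j

  step (play i κ) c j with j ∈ₛ? A | nth (successors c) i
  ... | yes _ | just c′ = check κ c′ (next j)
  ... | _ | _ = false
  step (respond κs) c j = isYes (¬? (j ∈ₛ? A)) ∧ checkAll κs (successors c) (next j)
  step (steal is₁ is₂) c j with run is₁ c j | run is₂ c j
  ... | just (e₁ , j₁) | just (e₂ , j₂) =
    isYes (steal-at? (length is₂ ∸ length is₁) e₁ j₁ e₂ j₂)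
  ... | _ | _ = false

  checkAll [] [] j = true
  checkAll (κ ∷ κs) (c ∷ cs) j = check κ c j ∧ checkAll κs cs j
  checkAll _ _ j = false

  check-sound : ∀ κ {c j} → T (check κ c j) →
                ∀ {z} → All (_≡ 0) z → HasTwoOnes c × Wins A (c ++ z) j
  step-sound : ∀ κ {c j} → T (step κ c j) → HasTwoOnes c →
               ∀ {z} → All (_≡ 0) z → Wins A (c ++ z) j
  checkAll-sound : ∀ κs {cs j} → T (checkAll κs cs j) → ∀ {c} → c ∈ cs →
                   ∀ {z} → All (_≡ 0) z → HasTwoOnes c × Wins A (c ++ z) j

  check-sound κ ok ones with Equivalence.to T-∧ ok
  ... | two-ok , step-ok = two , step-sound κ step-ok two ones
    where two = toWitness two-ok

  step-sound (play i κ) {c} {j} ok two {z} ones with j ∈ₛ? A | nth (successors c) i in c′-eq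
  ... | yes j∈A | just c′ =
    ours (c′ ++ z) j∈A (successors-sound (nth-∈ (successors c) i c′-eq) z)
      (inj₂ (proj₂ (check-sound κ ok ones)))
  step-sound (respond κs) {c} {j} ok two {z} ones with Equivalence.to T-∧ ok
  ... | j∉A , all-ok = theirs (toWitness j∉A) (HasTwoOnes⇒Move two z) all-lose
    where
    all-lose : ∀ t → Move (c ++ z) t → ¬ Zeck t × Wins A t (next j)
    all-lose t m =
      let _ , c′∈ , t↭ = find (successors-complete (ones-absorbed {c} ones two) m)
          two′ , w = checkAll-sound κs all-ok c′∈ ones
      in HasTwoOnes⇒¬Zeck z two′ ∘ Zeck-resp-↭ t↭ , Wins-resp-↭ (↭-sym t↭) w
  step-sound (steal is₁ is₂) {c} {j} ok two {z} ones with run is₁ c j in run₁ | run is₂ c j in run₂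
  ... | just (e₁ , j₁) | just (e₂ , j₂) with steal-sound {length is₂ ∸ length is₁} (toWitness ok) z
  ...   | inj₁ w = run-sound is₁ run₁ z w
  ...   | inj₂ w = run-sound is₂ run₂ z w

  checkAll-sound (κ ∷ κs) ok (here refl) ones = check-sound κ (proj₁ (Equivalence.to T-∧ ok)) ones
  checkAll-sound (κ ∷ κs) {_ ∷ _} ok (there c∈) ones =
    checkAll-sound κs (proj₂ (Equivalence.to T-∧ ok)) c∈ ones

certificate : Subset 6 → Certificate
certificate (inside ∷ inside ∷ inside ∷ inside ∷ outside ∷ outside ∷ []) =
  play 0 (play 0 (play 0 (play 0 (respond (respond (
    steal (0 ∷ 0 ∷ []) (1 ∷ 2 ∷ 1 ∷ 0 ∷ []) ∷
    steal (1 ∷ 0 ∷ []) (0 ∷ 1 ∷ 1 ∷ 0 ∷ []) ∷ []) ∷ [])))))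
certificate (inside ∷ inside ∷ inside ∷ outside ∷ inside ∷ outside ∷ []) =
  steal (0 ∷ 0 ∷ []) (0 ∷ 1 ∷ 0 ∷ [])
certificate (inside ∷ inside ∷ inside ∷ outside ∷ outside ∷ inside ∷ []) =
  play 0 (play 0 (play 0 (respond (
    respond (play 0 (play 1 (play 1 (play 0 (respond (
      respond (
        steal (0 ∷ []) (2 ∷ 1 ∷ 0 ∷ []) ∷ []) ∷
      respond (
        steal (0 ∷ 0 ∷ []) (0 ∷ 2 ∷ 1 ∷ 0 ∷ []) ∷
        steal (0 ∷ []) (2 ∷ 1 ∷ 0 ∷ []) ∷
        steal (1 ∷ 0 ∷ []) (0 ∷ 1 ∷ 0 ∷ 1 ∷ []) ∷ []) ∷ []))))) ∷ []) ∷
    respond (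
      play 0 (play 0 (play 0 (play 0 (respond (
        respond (
          steal (0 ∷ []) (2 ∷ 1 ∷ 0 ∷ []) ∷ []) ∷
        respond (
          steal (0 ∷ 0 ∷ []) (0 ∷ 2 ∷ 1 ∷ 0 ∷ []) ∷
          steal (0 ∷ []) (2 ∷ 1 ∷ 0 ∷ []) ∷
          steal (1 ∷ 0 ∷ []) (0 ∷ 1 ∷ 0 ∷ 1 ∷ []) ∷ []) ∷ []))))) ∷
      steal (1 ∷ []) (0 ∷ 1 ∷ 0 ∷ []) ∷ []) ∷
    respond (
      play 0 (play 1 (play 1 (play 0 (respond (
        respond (
          steal (0 ∷ []) (2 ∷ 1 ∷ 0 ∷ []) ∷ []) ∷
        respond (
          steal (0 ∷ 0 ∷ []) (0 ∷ 2 ∷ 1 ∷ 0 ∷ []) ∷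
          steal (0 ∷ []) (2 ∷ 1 ∷ 0 ∷ []) ∷
          steal (1 ∷ 0 ∷ []) (0 ∷ 1 ∷ 0 ∷ 1 ∷ []) ∷ []) ∷ []))))) ∷
      steal (1 ∷ 1 ∷ []) (0 ∷ 0 ∷ 1 ∷ 0 ∷ []) ∷
      steal (1 ∷ []) (0 ∷ 1 ∷ 0 ∷ []) ∷
      steal (0 ∷ []) (1 ∷ 0 ∷ 1 ∷ []) ∷ []) ∷ []))))
certificate (inside ∷ inside ∷ outside ∷ inside ∷ inside ∷ outside ∷ []) =
  play 0 (play 0 (respond (
    steal (0 ∷ []) (1 ∷ 0 ∷ []) ∷ [])))
certificate (inside ∷ inside ∷ outside ∷ inside ∷ outside ∷ inside ∷ []) =
  play 0 (play 0 (respond (play 0 (respond (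
    steal (0 ∷ []) (1 ∷ 0 ∷ []) ∷ [])) ∷ [])))
certificate (inside ∷ inside ∷ outside ∷ outside ∷ inside ∷ inside ∷ []) =
  play 0 (play 0 (respond (respond (
    play 0 (play 0 (play 0 (play 0 (respond (
      respond (
        steal (0 ∷ []) (2 ∷ 1 ∷ 0 ∷ []) ∷ []) ∷
      respond (
        steal (0 ∷ 0 ∷ []) (0 ∷ 2 ∷ 1 ∷ 0 ∷ []) ∷
        steal (0 ∷ []) (2 ∷ 1 ∷ 0 ∷ []) ∷
        steal (1 ∷ 0 ∷ []) (0 ∷ 1 ∷ 0 ∷ 1 ∷ []) ∷ []) ∷ []))))) ∷
    steal (1 ∷ 1 ∷ []) (0 ∷ 0 ∷ 1 ∷ 0 ∷ []) ∷
    steal (0 ∷ []) (1 ∷ 0 ∷ 0 ∷ []) ∷ []) ∷ [])))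
certificate (inside ∷ outside ∷ inside ∷ inside ∷ inside ∷ outside ∷ []) =
  play 0 (respond (
    steal (0 ∷ 0 ∷ []) (0 ∷ 1 ∷ 0 ∷ []) ∷
    steal (1 ∷ []) (0 ∷ 0 ∷ []) ∷ []))
certificate (inside ∷ outside ∷ inside ∷ inside ∷ outside ∷ inside ∷ []) =
  play 0 (respond (
    play 0 (play 0 (respond (
      steal (0 ∷ []) (1 ∷ 0 ∷ []) ∷ []))) ∷
    steal (1 ∷ []) (0 ∷ 0 ∷ []) ∷ []))
certificate (inside ∷ outside ∷ inside ∷ outside ∷ inside ∷ inside ∷ []) =
  play 0 (respond (
    play 0 (respond (
      steal (0 ∷ 0 ∷ []) (0 ∷ 1 ∷ 0 ∷ []) ∷
      steal (1 ∷ 1 ∷ []) (0 ∷ 0 ∷ 0 ∷ []) ∷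
      steal (2 ∷ []) (1 ∷ 1 ∷ []) ∷ [])) ∷
    play 0 (respond (
      steal (0 ∷ []) (1 ∷ 0 ∷ []) ∷ [])) ∷ []))
certificate (inside ∷ outside ∷ outside ∷ inside ∷ inside ∷ inside ∷ []) =
  play 0 (respond (
    respond (
      steal (0 ∷ []) (2 ∷ 1 ∷ 0 ∷ []) ∷ []) ∷
    respond (
      steal (0 ∷ 0 ∷ []) (0 ∷ 2 ∷ 1 ∷ 0 ∷ []) ∷
      steal (0 ∷ []) (2 ∷ 1 ∷ 0 ∷ []) ∷
      steal (1 ∷ 0 ∷ []) (0 ∷ 1 ∷ 0 ∷ 0 ∷ []) ∷ []) ∷ []))
certificate (outside ∷ inside ∷ inside ∷ inside ∷ inside ∷ outside ∷ []) =
  respond (play 0 (play 0 (play 1 (play 0 (respond (respond (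
    steal (0 ∷ 0 ∷ []) (1 ∷ 2 ∷ 1 ∷ 0 ∷ []) ∷
    steal (1 ∷ 0 ∷ []) (0 ∷ 1 ∷ 1 ∷ 0 ∷ []) ∷ []) ∷ []))))) ∷ [])
certificate (outside ∷ inside ∷ inside ∷ inside ∷ outside ∷ inside ∷ []) =
  respond (
    steal (0 ∷ []) (1 ∷ 0 ∷ []) ∷ [])
certificate (outside ∷ inside ∷ inside ∷ outside ∷ inside ∷ inside ∷ []) =
  respond (
    steal (0 ∷ []) (1 ∷ 0 ∷ []) ∷ [])
certificate (outside ∷ inside ∷ outside ∷ inside ∷ inside ∷ inside ∷ []) =
  respond (play 0 (respond (
    steal (0 ∷ []) (1 ∷ 0 ∷ []) ∷ [])) ∷ [])
certificate (outside ∷ outside ∷ inside ∷ inside ∷ inside ∷ inside ∷ []) =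
  respond (respond (
    steal (0 ∷ 0 ∷ []) (0 ∷ 2 ∷ 1 ∷ 0 ∷ []) ∷
    steal (1 ∷ 0 ∷ []) (0 ∷ 0 ∷ 1 ∷ 0 ∷ []) ∷ []) ∷ [])
-- Alliances of any other size get a certificate that fails the check.
certificate _ = respond []

certified : Subset 6 → Bool
certified A = not (∣ A ∣ ≡ᵇ 4) ∨ Check.check A (certificate A) (replicate 30 0) zero

all-certified : ∀ A → T (certified A)
-- The omitted proof of T (all-subsets certified) is found by evaluating all 64 checks.
all-certified = all-subsets-sound certified _

four-wins-from-30+ : ∀ A → ∣ A ∣ ≡ 4 → ∀ k → Wins A (replicate 30 0 ++ replicate k 0) zero
four-wins-from-30+ A ∣A∣≡4 k =
  proj₂ (Check.check-sound A (certificate A) {replicate 30 0} {zero}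
           (T-implication (≡⇒≡ᵇ ∣ A ∣ 4 ∣A∣≡4) (all-certified A)) (replicate⁺ k refl))

theorem1p3p3 : (n : ℕ) → 30 ≤ n → (A : Subset 6) → ∣ A ∣ ≡ 4 →
    Wins A (replicate n 0) zero
theorem1p3p3 n 30≤n A ∣A∣≡4 =
  let k , 30+k≡n = m≤n⇒∃[o]m+o≡n 30≤n
  in subst (λ m → Wins A (replicate m 0) zero) 30+k≡n (four-wins-from-30+ A ∣A∣≡4 k)
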